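{- Let $f:\{1,\dots,n\}\to\mathbb{N}^+$, let $\mathcal{R}$ be a box, let $\vec{\mathcal{S}}$ be a strip decomposition of $\mathcal{R}$, and for $x\in X(\mathcal{R})$ let $s(x)$ be the width of the strip of $\vec{\mathcal{S}}$ whose index set contains $x$. Let $\mu\in(0,1)$, and call an index $x\in X(\mathcal{R})$ safe if it is $(\mu,s(x))$-safe for $\mathcal{R}$ and unsafe otherwise. Let $\vec{\mathcal{D}}=(\mathcal{D}_1,\dots,\mathcal{D}_k)$ be a box chain compatible with $\vec{\mathcal{S}}$, and let $\vec{\mathcal{D}}^{\cup}=\bigcup_i\mathcal{D}_i$. Call $x$ a $\vec{\mathcal{D}}$-index if $F(x)\in\vec{\mathcal{D}}^{\cup}$; let $S$ be the set of safe $\vec{\mathcal{D}}$-indices and $U$ the set of unsafe $\vec{\mathcal{D}}$-indices. Let $\chi=|\mathcal{R}\cap\mathcal{F}|$, let $\chi^{in}=|\vec{\mathcal{D}}^{\cup}\cap\mathcal{F}|$ be the number of these points lying in $\vec{\mathcal{D}}^{\cup}$, and $\chi^{out}=\chi-\chi^{in}$. Then $$\chi^{out}\ge\frac{\mu}{1-\mu}|U|\quad\text{and}\quad \chi^{in}\le(1-\mu)\chi+\mu|S|.$$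
   Context: Points are pairs $\langle a,b\rangle$ of nonnegative integers; $x(P)$, $y(P)$ are the coordinates. $F(x)=\langle x,f(x)\rangle$ and $\mathcal{F}=\{F(x):1\le x\le n\}$. For points, $P\prec Q$ means $x(P)<x(Q)$ and $y(P)\le y(Q)$. Two $\mathcal{F}$-points $F(x),F(y)$ with $x<y$ are in violation (incomparable) if $f(x)>f(y)$. A box $\mathcal{B}$ is a product $X(\mathcal{B})\times Y(\mathcal{B})$ of a nonempty integer index interval $X(\mathcal{B})=(x_L,x_R]=\{x_L+1,\dots,x_R\}$ and a nonempty integer value interval $Y(\mathcal{B})=[y_B,y_T]$; its width is $\mathrm{w}(\mathcal{B})=x_R-x_L$, and $P_{BL}(\mathcal{B})=\langle x_L,y_B\rangle$, $P_{TR}(\mathcal{B})=\langle x_R,y_T\rangle$. An $\mathcal{R}$-strip is a subbox $\mathcal{S}$ of $\mathcal{R}$ with $Y(\mathcal{S})=Y(\mathcal{R})$; for an index interval $I\subseteq X(\mathcal{R})$ it is denoted $I\times Y(\mathcal{R})$. A strip decomposition of $\mathcal{R}$ is a partition of $\mathcal{R}$ into $\mathcal{R}$-strips, given by indices $x_L(\mathcal{R})=x_0<x_1<\dots<x_r=x_R(\mathcal{R})$ with strips $(x_{j-1},x_j]\times Y(\mathcal{R})$. A box chain is a sequence of boxes $\mathcal{D}_1,\dots,\mathcal{D}_k$ with $P_{TR}(\mathcal{D}_i)=P_{BL}(\mathcal{D}_{i+1})$; it is compatible with the strip decomposition $\vec{\mathcal{S}}$ of $\mathcal{R}$ if each $\mathcal{D}_i\subseteq\mathcal{R}$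 and the strips of $\vec{\mathcal{S}}$ are exactly $X(\mathcal{D}_i)\times Y(\mathcal{R})$, $i=1,\dots,k$. For an index $s$ and an $\mathcal{R}$-strip $\mathcal{S}$, $\mathrm{viol}(s,\mathcal{S})$ is the number of points $P\in\mathcal{S}\cap\mathcal{F}$ in violation with $F(s)$, and $Z(s,\mathcal{S})=\mathrm{viol}(s,\mathcal{S})-\mu|\mathcal{F}\cap\mathcal{S}|$. A strip $\mathcal{S}$ is adjacent to $s$ if the smallest index of $X(\mathcal{S})$ is $s+1$ or the largest index of $X(\mathcal{S})$ is $s-1$. An index $s\in X(\mathcal{R})$ is $(\mu,L)$-safe for $\mathcal{R}$ if every $\mathcal{R}$-strip $\mathcal{S}$ adjacent to $s$ satisfies $Z(s,\mathcal{S})\le L$.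
   Formalization: The parameter μ ranges over the rationals in the interval (0,1). -}

module Defs where

open import Data.Bool using (Bool; true; false; _∧_; _∨_; not; if_then_else_)
open import Data.Nat as ℕ using (ℕ; zero; suc; _+_; _∸_; _<ᵇ_; _≤ᵇ_)
open import Data.Integer as ℤ using (+_)
open import Data.List using (List; []; _∷_; applyUpTo)
open import Data.Bool.ListAction using (any; all)
open import Data.Rational as ℚ using (ℚ; _/_)
open import Data.Product using (_×_)
open import Relation.Binary.PropositionalEquality using (_≡_)

countB : (ℕ → Bool) → List ℕ → ℕ
countB p []       = 0
countB p (x ∷ xs) = if p x then suc (countB p xs) else countB p xs

-- the integer interval (a , b] = {a+1, ..., b} as a list
ivl : ℕ → ℕ → List ℕ
ivl a b = applyUpTo (λ i → suc (a + i)) (b ∸ a)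

dom : ℕ → List ℕ
dom n = ivl 0 n

toℚ : ℕ → ℚ
toℚ m = + m / 1

-- Boxes  X(B) × Y(B) = (xL , xR] × [yB , yT], both nonempty

record Box : Set where
  field
    xL xR yB yT : ℕ
    xL<xR : xL ℕ.< xR
    yB≤yT : yB ℕ.≤ yT
open Box public

inBox : Box → ℕ → ℕ → Bool
inBox B x y = (xL B <ᵇ x) ∧ (x ≤ᵇ xR B) ∧ (yB B ≤ᵇ y) ∧ (y ≤ᵇ yT B)

inY : Box → ℕ → Bool
inY R y = (yB R ≤ᵇ y) ∧ (y ≤ᵇ yT R)

countF : ℕ → (ℕ → ℕ) → Box → ℕ
countF n f B = countB (λ x → inBox B x (f x)) (dom n)

-- F(s) and F(y) are in violation (incomparable)
violB : (ℕ → ℕ) → ℕ → ℕ → Bool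
violB f s y = ((y <ᵇ s) ∧ (f s <ᵇ f y)) ∨ ((s <ᵇ y) ∧ (f y <ᵇ f s))

-- 𝓕-points in the strip (a , b] × Y(R): indices y ∈ {1..n} ∩ (a , b] with f y ∈ Y(R)
inStripF : ℕ → (ℕ → ℕ) → Box → ℕ → ℕ → ℕ → Bool
inStripF n f R a b y = (1 ≤ᵇ y) ∧ (y ≤ᵇ n) ∧ (a <ᵇ y) ∧ (y ≤ᵇ b) ∧ inY R (f y)

stripCount : ℕ → (ℕ → ℕ) → Box → ℕ → ℕ → ℕ
stripCount n f R a b = countB (inStripF n f R a b) (ivl a b)

viol : ℕ → (ℕ → ℕ) → Box → ℕ → ℕ → ℕ → ℕ
viol n f R s a b = countB (λ y → inStripF n f R a b y ∧ violB f s y) (ivl a b)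

Z : ℕ → (ℕ → ℕ) → ℚ → Box → ℕ → ℕ → ℕ → ℚ
Z n f μ R s a b = toℚ (viol n f R s a b) ℚ.- μ ℚ.* toℚ (stripCount n f R a b)

-- Adjacent R-strips are (s , b] × Y(R) with s < b ≤ xR(R)   (smallest index s+1),
-- and (a , s−1] × Y(R) with xL(R) ≤ a < s−1              (largest index s−1).
safeB : ℕ → (ℕ → ℕ) → ℚ → Box → ℕ → ℕ → Bool
safeB n f μ R L s =
  all (λ b → Z n f μ R s s b ℚ.≤ᵇ toℚ L) (ivl s (xR R))
  ∧ all (λ a → Z n f μ R s a (s ∸ 1) ℚ.≤ᵇ toℚ L)
        (applyUpTo (λ i → xL R + i) ((s ∸ 1) ∸ xL R))

-- Strip decompositions: x_L(R) = c 0 < c 1 < ... < c r = x_R(R),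
-- strips (c (j−1) , c j] × Y(R) for j = 1..r.

record StripDec (R : Box) : Set where
  field
    r    : ℕ
    cut  : ℕ → ℕ
    cut0 : cut 0 ≡ xL R
    cutr : cut r ≡ xR R
    incr : ∀ j → j ℕ.< r → cut j ℕ.< cut (suc j)
open StripDec public

-- s(x): width of the strip (cut (j−1) , cut j] containing x (0 if none)
widthAux : (ℕ → ℕ) → ℕ → ℕ → ℕ
widthAux c zero    x = 0
widthAux c (suc j) x =
  if (c j <ᵇ x) ∧ (x ≤ᵇ c (suc j)) then c (suc j) ∸ c j else widthAux c j x

stripWidth : {R : Box} → StripDec R → ℕ → ℕ
stripWidth S x = widthAux (cut S) (r S) x

-- Box chains D 1 , ... , D k (boxes indexed by 1..k; values of D at other
-- indices are irrelevant) compatible with a strip decomposition S of R.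

record Compatible (R : Box) (S : StripDec R) (k : ℕ) (D : ℕ → Box) : Set where
  field
    k≡r    : k ≡ r S
    -- X(D i) = (cut (i−1) , cut i], so the strips of S are X(D i) × Y(R)
    xL-D   : ∀ i → 1 ℕ.≤ i → i ℕ.≤ k → xL (D i) ≡ cut S (i ∸ 1)
    xR-D   : ∀ i → 1 ℕ.≤ i → i ℕ.≤ k → xR (D i) ≡ cut S i
    -- D i ⊆ R (the X-part follows from the above)
    yB-D   : ∀ i → 1 ℕ.≤ i → i ℕ.≤ k → yB R ℕ.≤ yB (D i)
    yT-D   : ∀ i → 1 ℕ.≤ i → i ℕ.≤ k → yT (D i) ℕ.≤ yT R
    -- chain condition P_TR(D i) = P_BL(D (i+1))
    chain  : ∀ i → 1 ℕ.≤ i → i ℕ.< k →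
             (xR (D i) ≡ xL (D (suc i))) × (yT (D i) ≡ yB (D (suc i)))

inChain : (ℕ → ℕ) → ℕ → (ℕ → Box) → ℕ → Bool
inChain f k D x = any (λ i → inBox (D i) x (f x)) (ivl 0 k)

isSafe : ℕ → (ℕ → ℕ) → ℚ → (R : Box) → StripDec R → ℕ → Bool
isSafe n f μ R S x = safeB n f μ R (stripWidth S x) x

numSafeIdx : ℕ → (ℕ → ℕ) → ℚ → (R : Box) → StripDec R → ℕ → (ℕ → Box) → ℕ
numSafeIdx n f μ R S k D = countB (λ x → inChain f k D x ∧ isSafe n f μ R S x) (dom n)

numUnsafeIdx : ℕ → (ℕ → ℕ) → ℚ → (R : Box) → StripDec R → ℕ → (ℕ → Box) → ℕ
numUnsafeIdx n f μ R S k D = countB (λ x → inChain f k D x ∧ not (isSafe n f μ R S x)) (dom n)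

chi : ℕ → (ℕ → ℕ) → Box → ℕ
chi n f R = countF n f R

chiIn : ℕ → (ℕ → ℕ) → ℕ → (ℕ → Box) → ℕ
chiIn n f k D = countB (inChain f k D) (dom n)

chiOut : ℕ → (ℕ → ℕ) → Box → ℕ → (ℕ → Box) → ℚ
chiOut n f R k D = toℚ (chi n f R) ℚ.- toℚ (chiIn n f k D)

module Submission where

-- Both
-- claims follow by linear algebra (closing-bounds) from χ = |S| + |U| + χout,
-- χin = |S| + |U| and the key inequality μ·|U| ≤ (1 − μ)·χout.
--
-- Split the points of R off the chain into those below and those above the
-- box over their column.  An unsafe D-index x in box i has an adjacent strip
-- with viol > s(x) + μ·#points.  For a right strip, fewer than s(x) of its
-- violators lie in column i and all others lie below the chain; for a left
-- strip the others lie above the chain.  Counting (unsafe-strip-arith,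
-- strip-estimate) gives μ·#In ≤ (1 − μ)·#Below (resp. #Above) on the block of
-- x and its strip, and a greedy sweep over these blocks (module Covering)
-- yields the key inequality.

open import Defs
open import Data.Bool using (Bool; true; false; _∧_; _∨_; not; if_then_else_; T)
open import Data.Bool.Properties using (T-∧; T-∨; T-≡; T?)
open import Data.Nat as ℕ using (ℕ; zero; suc; _+_; _∸_; _≤_; _<_; z≤n; s≤s; z<s; _<ᵇ_; _≤ᵇ_)
import Data.Nat.Properties as ℕP
open import Data.Nat.Induction using (<-rec)
open import Data.Nat.Coprimality using (1-coprimeTo) renaming (sym to coprime-sym)
import Data.Integer as ℤ
import Data.Integer.Properties as ℤP
open import Data.List using (applyUpTo)
open import Data.Bool.ListAction using (any; all)
import Data.List.Relation.Unary.All.Properties as AllP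
import Data.List.Relation.Unary.Any.Properties as AnyP
open import Data.Product using (Σ; _×_; _,_; proj₁; proj₂)
open import Data.Sum using (_⊎_; inj₁; inj₂)
open import Data.Empty using (⊥; ⊥-elim)
open import Data.Unit using (tt)
open import Function.Bundles using (Equivalence)
open import Function.Base using (_∘_)
open import Relation.Nullary using (¬_; yes; no)
open import Relation.Binary.PropositionalEquality
open import Data.Rational as ℚ using (ℚ; 0ℚ; 1ℚ; mkℚ)
import Data.Rational.Properties as ℚP
import Data.Rational.Unnormalised as ℚᵘ
import Data.Rational.Unnormalised.Properties as ℚᵘP
open import Data.Rational.Solver using (module +-*-Solver)
open +-*-Solver using (solve; _:+_; _:*_; _:-_; :-_; _:=_; con)

toℚ≡mkℚ : ∀ m → toℚ m ≡ mkℚ (ℤ.+ m) 0 (coprime-sym (1-coprimeTo m))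
toℚ≡mkℚ m = ℚP.↥p/↧p≡p (mkℚ (ℤ.+ m) 0 (coprime-sym (1-coprimeTo m)))

toℚ-+ : ∀ a b → toℚ (a + b) ≡ toℚ a ℚ.+ toℚ b
toℚ-+ a b = ℚP.toℚᵘ-injective (ℚᵘP.≃-trans sum-unnormalised
  (ℚᵘP.≃-sym (ℚP.toℚᵘ-homo-+ (toℚ a) (toℚ b))))
  where
  sum-unnormalised : ℚ.toℚᵘ (toℚ (a + b)) ℚᵘ.≃ ℚ.toℚᵘ (toℚ a) ℚᵘ.+ ℚ.toℚᵘ (toℚ b)
  sum-unnormalised rewrite toℚ≡mkℚ (a + b) | toℚ≡mkℚ a | toℚ≡mkℚ b =
    ℚᵘ.*≡* (cong (ℤ._* ℤ.+ 1) (sym (cong₂ ℤ._+_ (ℤP.*-identityʳ (ℤ.+ a)) (ℤP.*-identityʳ (ℤ.+ b)))))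

toℚ-mono : ∀ {a b} → a ≤ b → toℚ a ℚ.≤ toℚ b
toℚ-mono {a} {b} a≤b rewrite toℚ≡mkℚ a | toℚ≡mkℚ b =
  ℚ.*≤* (subst₂ ℤ._≤_ (sym (ℤP.*-identityʳ (ℤ.+ a))) (sym (ℤP.*-identityʳ (ℤ.+ b))) (ℤ.+≤+ a≤b))

-- An opaque copy ⟦_⟧ of toℚ: arithmetic on counts goes through the facts
-- below, and the normaliser never unfolds the gcd inside m/1.
opaque
  ⟦_⟧ : ℕ → ℚ
  ⟦_⟧ = toℚ

  ⟦⟧≡toℚ : ∀ m → ⟦ m ⟧ ≡ toℚ m
  ⟦⟧≡toℚ m = refl

  ⟦⟧-+ : ∀ a b → ⟦ a + b ⟧ ≡ ⟦ a ⟧ ℚ.+ ⟦ b ⟧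
  ⟦⟧-+ = toℚ-+

  ⟦⟧-mono : ∀ {a b} → a ≤ b → ⟦ a ⟧ ℚ.≤ ⟦ b ⟧
  ⟦⟧-mono = toℚ-mono

  ⟦0⟧ : ⟦ 0 ⟧ ≡ 0ℚ
  ⟦0⟧ = refl

  ⟦1⟧ : ⟦ 1 ⟧ ≡ 1ℚ
  ⟦1⟧ = refl

⟦⟧-suc : ∀ m → ⟦ suc m ⟧ ≡ 1ℚ ℚ.+ ⟦ m ⟧
⟦⟧-suc m = trans (⟦⟧-+ 1 m) (cong (ℚ._+ ⟦ m ⟧) ⟦1⟧)

⟦⟧-distrib : ∀ γ a b → γ ℚ.* ⟦ a + b ⟧ ≡ γ ℚ.* ⟦ a ⟧ ℚ.+ γ ℚ.* ⟦ b ⟧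
⟦⟧-distrib γ a b = trans (cong (γ ℚ.*_) (⟦⟧-+ a b)) (ℚP.*-distribˡ-+ γ ⟦ a ⟧ ⟦ b ⟧)

scale : ∀ {r p q} → 0ℚ ℚ.≤ r → p ℚ.≤ q → r ℚ.* p ℚ.≤ r ℚ.* q
scale {r} r≥0 = ℚP.*-monoˡ-≤-nonNeg r {{ℚ.nonNegative r≥0}}

move-sub : ∀ {a b c} → a ℚ.≤ b ℚ.- c → c ℚ.≤ b ℚ.- a
move-sub {a} {b} {c} h = subst₂ ℚ._≤_
  (solve 2 (λ a c → a :+ (c :- a) := c) refl a c)
  (solve 3 (λ a b c → (b :- c) :+ (c :- a) := b :- a) refl a b c)
  (ℚP.+-monoˡ-≤ (c ℚ.- a) h)

move-sum : ∀ {a b c d} → c ℚ.+ a ℚ.≤ b ℚ.+ d → a ℚ.- b ℚ.≤ d ℚ.- c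
move-sum {a} {b} {c} {d} h = subst₂ ℚ._≤_
  (solve 3 (λ a b c → (c :+ a) :+ ((:- b) :- c) := a :- b) refl a b c)
  (solve 3 (λ b c d → (b :+ d) :+ ((:- b) :- c) := d :- c) refl b c d)
  (ℚP.+-monoˡ-≤ (ℚ.- b ℚ.- c) h)

-- Suppose a strip with c points
-- has v violators and is unsafe at width s, i.e. s ≤ v − μ·c; suppose at
-- most s − 1 of the violators escape the β out-points (v < s + β) and the
-- ι in-points and β out-points are distinct points of the strip.  Then
-- μ·(1 + ι) ≤ (1 − μ)·β.
unsafe-strip-arith : ∀ (μ : ℚ) → 0ℚ ℚ.≤ μ → μ ℚ.≤ 1ℚ → ∀ {s v c ι β} →
  suc v ≤ s + β → ι + β ≤ c → ⟦ s ⟧ ℚ.≤ ⟦ v ⟧ ℚ.- μ ℚ.* ⟦ c ⟧ →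
  μ ℚ.* ⟦ suc ι ⟧ ℚ.≤ (1ℚ ℚ.- μ) ℚ.* ⟦ β ⟧
unsafe-strip-arith μ μ≥0 μ≤1 {s} {v} {c} {ι} {β} v<s+β ι+β≤c unsafe = begin
  μ ℚ.* ⟦ suc ι ⟧                        ≡⟨ trans (cong (μ ℚ.*_) (⟦⟧-suc ι)) (ℚP.*-distribˡ-+ μ 1ℚ I) ⟩
  μ ℚ.* 1ℚ ℚ.+ μ ℚ.* I                   ≤⟨ ℚP.+-monoˡ-≤ (μ ℚ.* I) (subst (ℚ._≤ 1ℚ) (sym (ℚP.*-identityʳ μ)) μ≤1) ⟩
  1ℚ ℚ.+ μ ℚ.* I                         ≡⟨ solve 3 (λ μ I B → con 1ℚ :+ μ :* I := (con 1ℚ :+ μ :* (I :+ B)) :- μ :* B) refl μ I B ⟩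
  (1ℚ ℚ.+ μ ℚ.* (I ℚ.+ B)) ℚ.- μ ℚ.* B   ≤⟨ ℚP.+-monoˡ-≤ (ℚ.- (μ ℚ.* B)) (ℚP.+-monoʳ-≤ 1ℚ (scale μ≥0 I+B≤C)) ⟩
  (1ℚ ℚ.+ μ ℚ.* C) ℚ.- μ ℚ.* B           ≤⟨ ℚP.+-monoˡ-≤ (ℚ.- (μ ℚ.* B)) (ℚP.+-monoʳ-≤ 1ℚ (move-sub {S} {V} unsafe)) ⟩
  (1ℚ ℚ.+ (V ℚ.- S)) ℚ.- μ ℚ.* B         ≤⟨ ℚP.+-monoˡ-≤ (ℚ.- (μ ℚ.* B)) (ℚP.+-monoʳ-≤ 1ℚ (move-sum {V} {S} {1ℚ} {B} 1+V≤S+B)) ⟩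
  (1ℚ ℚ.+ (B ℚ.- 1ℚ)) ℚ.- μ ℚ.* B        ≡⟨ solve 2 (λ μ B → (con 1ℚ :+ (B :- con 1ℚ)) :- μ :* B := (con 1ℚ :- μ) :* B) refl μ B ⟩
  (1ℚ ℚ.- μ) ℚ.* B                       ∎
  where
  open ℚP.≤-Reasoning
  S = ⟦ s ⟧
  V = ⟦ v ⟧
  C = ⟦ c ⟧
  I = ⟦ ι ⟧
  B = ⟦ β ⟧
  I+B≤C : I ℚ.+ B ℚ.≤ C
  I+B≤C = subst (ℚ._≤ C) (⟦⟧-+ ι β) (⟦⟧-mono ι+β≤c)
  1+V≤S+B : 1ℚ ℚ.+ V ℚ.≤ S ℚ.+ B
  1+V≤S+B = subst₂ ℚ._≤_ (⟦⟧-suc v) (⟦⟧-+ s β) (⟦⟧-mono v<s+β)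

closing-bounds : ∀ μ .{{_ : ℚ.NonZero (1ℚ ℚ.- μ)}} → 0ℚ ℚ.< μ → μ ℚ.< 1ℚ → ∀ χ χin s u o →
  χ ≡ (s + u) + o → χin ≡ s + u → μ ℚ.* ⟦ u ⟧ ℚ.≤ (1ℚ ℚ.- μ) ℚ.* ⟦ o ⟧ →
  (toℚ χ ℚ.- toℚ χin ℚ.≥ (μ ℚ.÷ (1ℚ ℚ.- μ)) ℚ.* toℚ u)
  × (toℚ χin ℚ.≤ (1ℚ ℚ.- μ) ℚ.* toℚ χ ℚ.+ μ ℚ.* toℚ s)
closing-bounds μ 0<μ μ<1 _ _ s u o refl refl key
  rewrite sym (⟦⟧≡toℚ ((s + u) + o)) | sym (⟦⟧≡toℚ (s + u)) | sym (⟦⟧≡toℚ u) | sym (⟦⟧≡toℚ s)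
        | ⟦⟧-+ (s + u) o | ⟦⟧-+ s u = out-bound , in-bound
  where
  open ℚP.≤-Reasoning
  S = ⟦ s ⟧
  U = ⟦ u ⟧
  O = ⟦ o ⟧
  1-μ>0 : 0ℚ ℚ.< 1ℚ ℚ.- μ
  1-μ>0 = subst (ℚ._< 1ℚ ℚ.- μ) (ℚP.+-inverseʳ μ) (ℚP.+-monoˡ-< (ℚ.- μ) μ<1)
  w : ℚ
  w = ℚ.1/ (1ℚ ℚ.- μ)
  w≥0 : 0ℚ ℚ.≤ w
  w≥0 = ℚP.<⇒≤ (ℚP.positive⁻¹ w {{ℚP.1/pos⇒pos (1ℚ ℚ.- μ) {{ℚ.positive 1-μ>0}}}})
  out-bound : (S ℚ.+ U) ℚ.+ O ℚ.- (S ℚ.+ U) ℚ.≥ (μ ℚ.÷ (1ℚ ℚ.- μ)) ℚ.* U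
  out-bound = begin
    (μ ℚ.* w) ℚ.* U            ≡⟨ solve 3 (λ μ w U → (μ :* w) :* U := w :* (μ :* U)) refl μ w U ⟩
    w ℚ.* (μ ℚ.* U)            ≤⟨ scale w≥0 key ⟩
    w ℚ.* ((1ℚ ℚ.- μ) ℚ.* O)   ≡⟨ ℚP.*-assoc w (1ℚ ℚ.- μ) O ⟨
    (w ℚ.* (1ℚ ℚ.- μ)) ℚ.* O   ≡⟨ cong (ℚ._* O) (ℚP.*-inverseˡ (1ℚ ℚ.- μ)) ⟩
    1ℚ ℚ.* O                   ≡⟨ solve 3 (λ S U O → con 1ℚ :* O := ((S :+ U) :+ O) :- (S :+ U)) refl S U O ⟩
    (S ℚ.+ U) ℚ.+ O ℚ.- (S ℚ.+ U) ∎
  in-bound : S ℚ.+ U ℚ.≤ (1ℚ ℚ.- μ) ℚ.* ((S ℚ.+ U) ℚ.+ O) ℚ.+ μ ℚ.* S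
  in-bound = begin
    S ℚ.+ U                                                  ≡⟨ solve 3 (λ μ S U → S :+ U := ((con 1ℚ :- μ) :* (S :+ U) :+ μ :* S) :+ μ :* U) refl μ S U ⟩
    ((1ℚ ℚ.- μ) ℚ.* (S ℚ.+ U) ℚ.+ μ ℚ.* S) ℚ.+ μ ℚ.* U       ≤⟨ ℚP.+-monoʳ-≤ ((1ℚ ℚ.- μ) ℚ.* (S ℚ.+ U) ℚ.+ μ ℚ.* S) key ⟩
    ((1ℚ ℚ.- μ) ℚ.* (S ℚ.+ U) ℚ.+ μ ℚ.* S) ℚ.+ (1ℚ ℚ.- μ) ℚ.* O ≡⟨ solve 4 (λ μ S U O → ((con 1ℚ :- μ) :* (S :+ U) :+ μ :* S) :+ (con 1ℚ :- μ) :* O := (con 1ℚ :- μ) :* ((S :+ U) :+ O) :+ μ :* S) refl μ S U O ⟩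
    (1ℚ ℚ.- μ) ℚ.* ((S ℚ.+ U) ℚ.+ O) ℚ.+ μ ℚ.* S             ∎

∧-elim : ∀ {a b} → T (a ∧ b) → T a × T b
∧-elim = Equivalence.to T-∧

∧-intro : ∀ {a b} → T a → T b → T (a ∧ b)
∧-intro p q = Equivalence.from T-∧ (p , q)

not⇒¬ : ∀ {b} → T (not b) → ¬ T b
not⇒¬ {true}  ()
not⇒¬ {false} _ ()

¬⇒not : ∀ {b} → ¬ T b → T (not b)
¬⇒not {true}  ¬b = ¬b tt
¬⇒not {false} _  = tt

∧-absorb : ∀ a b → (T b → T a) → a ∧ b ≡ b
∧-absorb true  b     _   = refl
∧-absorb false false _   = refl
∧-absorb false true  b⇒a = ⊥-elim (b⇒a tt)

∧-not-elim : ∀ {a b c} → T (a ∧ (b ∧ not c)) → T (a ∧ b) × ¬ T c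
∧-not-elim {true} {true} {false} _ = tt , λ ()

∧-not-split : ∀ a b c d → T (a ∧ (b ∧ not (c ∧ d))) → T (a ∧ (b ∧ not c)) ⊎ T (a ∧ (b ∧ not d))
∧-not-split true true false _     _ = inj₁ tt
∧-not-split true true true  false _ = inj₂ tt

inBox⇒ : ∀ B x y → T (inBox B x y) → xL B < x × x ≤ xR B × yB B ≤ y × y ≤ yT B
inBox⇒ B x y h =
  let (p₁ , h₁) = ∧-elim {xL B <ᵇ x} h
      (p₂ , h₂) = ∧-elim {x ≤ᵇ xR B} h₁
      (p₃ , p₄) = ∧-elim {yB B ≤ᵇ y} h₂
  in ℕP.<ᵇ⇒< _ _ p₁ , ℕP.≤ᵇ⇒≤ _ _ p₂ , ℕP.≤ᵇ⇒≤ _ _ p₃ , ℕP.≤ᵇ⇒≤ _ _ p₄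

viol-right : ∀ f {s y} → s < y → T (violB f s y) → f y < f s
viol-right f {s} {y} s<y h with Equivalence.to (T-∨ {(y <ᵇ s) ∧ (f s <ᵇ f y)}) h
... | inj₁ p = ⊥-elim (ℕP.<-asym s<y (ℕP.<ᵇ⇒< _ _ (proj₁ (∧-elim {y <ᵇ s} p))))
... | inj₂ p = ℕP.<ᵇ⇒< _ _ (proj₂ (∧-elim {s <ᵇ y} p))

viol-left : ∀ f {s y} → y < s → T (violB f s y) → f s < f y
viol-left f {s} {y} y<s h with Equivalence.to (T-∨ {(y <ᵇ s) ∧ (f s <ᵇ f y)}) h
... | inj₁ p = ℕP.<ᵇ⇒< _ _ (proj₂ (∧-elim {y <ᵇ s} p))
... | inj₂ p = ⊥-elim (ℕP.<-asym y<s (ℕP.<ᵇ⇒< _ _ (proj₁ (∧-elim {s <ᵇ y} p))))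

all-failure : ∀ (p : ℕ → Bool) g m → ¬ T (all p (applyUpTo g m)) → Σ ℕ λ j → j < m × ¬ T (p (g j))
all-failure p g m h = AnyP.applyUpTo⁻ g (AllP.¬All⇒Any¬ (λ y → T? (p y)) _ (λ ps → h (AllP.all⁻ p ps)))

cnt : (ℕ → Bool) → ℕ → ℕ → ℕ
cnt P a zero    = 0
cnt P a (suc m) = if P a then suc (cnt P (suc a) m) else cnt P (suc a) m

countB-upTo : ∀ (P : ℕ → Bool) (g : ℕ → ℕ) a m → (∀ i → g i ≡ a + i) → countB P (applyUpTo g m) ≡ cnt P a m
countB-upTo P g a zero    g≡ = refl
countB-upTo P g a (suc m) g≡ rewrite g≡ 0 | ℕP.+-identityʳ a with P a
... | true  = cong suc (countB-upTo P (λ i → g (suc i)) (suc a) m (λ i → trans (g≡ (suc i)) (ℕP.+-suc a i)))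
... | false = countB-upTo P (λ i → g (suc i)) (suc a) m (λ i → trans (g≡ (suc i)) (ℕP.+-suc a i))

countB-ivl : ∀ (P : ℕ → Bool) a b → countB P (ivl a b) ≡ cnt P (suc a) (b ∸ a)
countB-ivl P a b = countB-upTo P _ (suc a) (b ∸ a) (λ i → refl)

OnRange : ℕ → ℕ → (ℕ → Set) → Set
OnRange a m Φ = ∀ y → a ≤ y → y < a + m → Φ y

module _ {Φ : ℕ → Set} where
  on-tail : ∀ {a m} → OnRange a (suc m) Φ → OnRange (suc a) m Φ
  on-tail {a} {m} h y a<y y<end = h y (ℕP.<⇒≤ a<y) (subst (y <_) (sym (ℕP.+-suc a m)) y<end)

  on-head : ∀ {a m} → OnRange a (suc m) Φ → Φ a
  on-head {a} h = h a ℕP.≤-refl (ℕP.m<m+n a z<s)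

_⇒_ : (ℕ → Bool) → (ℕ → Bool) → ℕ → Set
(P ⇒ Q) y = T (P y) → T (Q y)

cnt-++ : ∀ (P : ℕ → Bool) a m t → cnt P a (m + t) ≡ cnt P a m + cnt P (a + m) t
cnt-++ P a zero    t rewrite ℕP.+-identityʳ a = refl
cnt-++ P a (suc m) t rewrite cnt-++ P (suc a) m t | ℕP.+-suc a m with P a
... | true  = refl
... | false = refl

cnt-snoc : ∀ (P : ℕ → Bool) a m → cnt P a (suc m) ≡ cnt P a m + cnt P (a + m) 1
cnt-snoc P a m = trans (cong (cnt P a) (ℕP.+-comm 1 m)) (cnt-++ P a m 1)

cnt-cons-yes : ∀ (P : ℕ → Bool) a m → T (P a) → cnt P a (suc m) ≡ suc (cnt P (suc a) m)
cnt-cons-yes P a m pa with P a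
... | true = refl

cnt-cons-no : ∀ (P : ℕ → Bool) a m → ¬ T (P a) → cnt P a (suc m) ≡ cnt P (suc a) m
cnt-cons-no P a m ¬pa with P a
... | true  = ⊥-elim (¬pa tt)
... | false = refl

cnt-snoc-yes : ∀ (P : ℕ → Bool) a m → T (P (a + m)) → cnt P a (suc m) ≡ suc (cnt P a m)
cnt-snoc-yes P a m p = trans (cnt-snoc P a m) (trans (cong (cnt P a m +_) (cnt-cons-yes P (a + m) 0 p)) (ℕP.+-comm _ 1))

cnt-snoc-no : ∀ (P : ℕ → Bool) a m → ¬ T (P (a + m)) → cnt P a (suc m) ≡ cnt P a m
cnt-snoc-no P a m ¬p = trans (cnt-snoc P a m) (trans (cong (cnt P a m +_) (cnt-cons-no P (a + m) 0 ¬p)) (ℕP.+-identityʳ _))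

cnt-init-≤ : ∀ (P : ℕ → Bool) a m → cnt P a m ≤ cnt P a (suc m)
cnt-init-≤ P a m = subst (cnt P a m ≤_) (sym (cnt-snoc P a m)) (ℕP.m≤m+n _ _)

cnt-tail-≤ : ∀ (P : ℕ → Bool) a m → cnt P (suc a) m ≤ cnt P a (suc m)
cnt-tail-≤ P a m with P a
... | true  = ℕP.n≤1+n _
... | false = ℕP.≤-refl

cnt-mono : ∀ (P Q : ℕ → Bool) a m → OnRange a m (P ⇒ Q) → cnt P a m ≤ cnt Q a m
cnt-mono P Q a zero    h = z≤n
cnt-mono P Q a (suc m) h with P a | Q a | on-head h
... | true  | true  | _  = s≤s (cnt-mono P Q (suc a) m (on-tail h))
... | true  | false | ha = ⊥-elim (ha tt)
... | false | true  | _  = ℕP.m≤n⇒m≤1+n (cnt-mono P Q (suc a) m (on-tail h))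
... | false | false | _  = cnt-mono P Q (suc a) m (on-tail h)

cnt-cong : ∀ (P Q : ℕ → Bool) a m → OnRange a m (λ y → P y ≡ Q y) → cnt P a m ≡ cnt Q a m
cnt-cong P Q a zero    h = refl
cnt-cong P Q a (suc m) h rewrite on-head h | cnt-cong P Q (suc a) m (on-tail h) = refl

cnt-none : ∀ (P : ℕ → Bool) a m → OnRange a m (λ y → ¬ T (P y)) → cnt P a m ≡ 0
cnt-none P a zero    h = refl
cnt-none P a (suc m) h with P a | on-head h
... | true  | ¬pa = ⊥-elim (¬pa tt)
... | false | _   = cnt-none P (suc a) m (on-tail h)

cnt-∧-split : ∀ (P Q : ℕ → Bool) a m → cnt P a m ≡ cnt (λ y → P y ∧ Q y) a m + cnt (λ y → P y ∧ not (Q y)) a m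
cnt-∧-split P Q a zero    = refl
cnt-∧-split P Q a (suc m) with P a | Q a
... | true  | true  = cong suc (cnt-∧-split P Q (suc a) m)
... | true  | false = trans (cong suc (cnt-∧-split P Q (suc a) m)) (sym (ℕP.+-suc _ _))
... | false | _     = cnt-∧-split P Q (suc a) m

cnt-∨ : ∀ (P Q : ℕ → Bool) a m → cnt (λ y → P y ∨ Q y) a m + cnt (λ y → P y ∧ Q y) a m ≡ cnt P a m + cnt Q a m
cnt-∨ P Q a zero    = refl
cnt-∨ P Q a (suc m) with P a | Q a
... | true  | true  = cong suc (trans (ℕP.+-suc _ _) (trans (cong suc (cnt-∨ P Q (suc a) m)) (sym (ℕP.+-suc _ _))))
... | true  | false = cong suc (cnt-∨ P Q (suc a) m)
... | false | true  = trans (cong suc (cnt-∨ P Q (suc a) m)) (sym (ℕP.+-suc _ _))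
... | false | false = cnt-∨ P Q (suc a) m

cnt-cover : ∀ (P Q R : ℕ → Bool) a m → OnRange a m (λ y → T (P y) → T (Q y) ⊎ T (R y)) →
            cnt P a m ≤ cnt Q a m + cnt R a m
cnt-cover P Q R a m h = begin
  cnt P a m                                             ≤⟨ cnt-mono P (λ y → Q y ∨ R y) a m (λ y a≤y y< p → Equivalence.from T-∨ (h y a≤y y< p)) ⟩
  cnt (λ y → Q y ∨ R y) a m                             ≤⟨ ℕP.m≤m+n _ _ ⟩
  cnt (λ y → Q y ∨ R y) a m + cnt (λ y → Q y ∧ R y) a m ≡⟨ cnt-∨ Q R a m ⟩
  cnt Q a m + cnt R a m                                 ∎
  where open ℕP.≤-Reasoning

cnt-disjoint : ∀ (P Q R : ℕ → Bool) a m → OnRange a m (P ⇒ R) → OnRange a m (Q ⇒ R) →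
               OnRange a m (λ y → T (P y) → T (Q y) → ⊥) → cnt P a m + cnt Q a m ≤ cnt R a m
cnt-disjoint P Q R a m P⇒R Q⇒R disj = begin
  cnt P a m + cnt Q a m                                 ≡⟨ cnt-∨ P Q a m ⟨
  cnt (λ y → P y ∨ Q y) a m + cnt (λ y → P y ∧ Q y) a m ≡⟨ cong (cnt (λ y → P y ∨ Q y) a m +_) (cnt-none _ a m none) ⟩
  cnt (λ y → P y ∨ Q y) a m + 0                         ≡⟨ ℕP.+-identityʳ _ ⟩
  cnt (λ y → P y ∨ Q y) a m                             ≤⟨ cnt-mono _ R a m P∨Q⇒R ⟩
  cnt R a m                                             ∎
  where
  open ℕP.≤-Reasoning
  none : OnRange a m (λ y → ¬ T (P y ∧ Q y))
  none y a≤y y< pq = let (p , q) = ∧-elim {P y} pq in disj y a≤y y< p q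
  P∨Q⇒R : OnRange a m ((λ y → P y ∨ Q y) ⇒ R)
  P∨Q⇒R y a≤y y< pq with Equivalence.to T-∨ pq
  ... | inj₁ p = P⇒R y a≤y y< p
  ... | inj₂ q = Q⇒R y a≤y y< q

cnt-≤ᵇ : ∀ b a m → cnt (_≤ᵇ b) a m ≤ suc b ∸ a
cnt-≤ᵇ b a zero    = z≤n
cnt-≤ᵇ b a (suc m) with a ≤ᵇ b in e
... | true  = subst (suc (cnt (_≤ᵇ b) (suc a) m) ≤_) (sym (ℕP.+-∸-assoc 1 (ℕP.≤ᵇ⇒≤ a b (subst T (sym e) tt))))
                (s≤s (cnt-≤ᵇ b (suc a) m))
... | false = ℕP.≤-trans (cnt-≤ᵇ b (suc a) m) (ℕP.∸-monoˡ-≤ a (ℕP.n≤1+n b))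

cnt->ᵇ : ∀ b a m → cnt (b <ᵇ_) a m ≤ (a + m) ∸ suc b
cnt->ᵇ b a zero    = z≤n
cnt->ᵇ b a (suc m) with T? (b <ᵇ a + m)
... | yes b<last = begin
  cnt (b <ᵇ_) a (suc m)      ≡⟨ cnt-snoc-yes (b <ᵇ_) a m b<last ⟩
  suc (cnt (b <ᵇ_) a m)      ≤⟨ s≤s (cnt->ᵇ b a m) ⟩
  suc ((a + m) ∸ suc b)      ≡⟨ ℕP.+-∸-assoc 1 (ℕP.<ᵇ⇒< b (a + m) b<last) ⟨
  (a + m) ∸ b                ≡⟨ cong (_∸ suc b) (ℕP.+-suc a m) ⟨
  (a + suc m) ∸ suc b        ∎
  where open ℕP.≤-Reasoning
... | no b≮last = begin
  cnt (b <ᵇ_) a (suc m)      ≡⟨ cnt-snoc-no (b <ᵇ_) a m b≮last ⟩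
  cnt (b <ᵇ_) a m            ≤⟨ cnt->ᵇ b a m ⟩
  (a + m) ∸ suc b            ≤⟨ ℕP.∸-monoʳ-≤ (a + m) (ℕP.n≤1+n b) ⟩
  (a + m) ∸ b                ≡⟨ cong (_∸ suc b) (ℕP.+-suc a m) ⟨
  (a + suc m) ∸ suc b        ∎
  where open ℕP.≤-Reasoning

cnt-guard : ∀ (P : ℕ → Bool) n e → cnt P 1 n ≡ cnt (λ y → (y ≤ᵇ n) ∧ P y) 1 (n + e)
cnt-guard P n e = sym (begin
  cnt P≤n 1 (n + e)                ≡⟨ cnt-++ P≤n 1 n e ⟩
  cnt P≤n 1 n + cnt P≤n (1 + n) e  ≡⟨ cong₂ _+_ guarded beyond ⟩
  cnt P 1 n + 0                    ≡⟨ ℕP.+-identityʳ _ ⟩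
  cnt P 1 n                        ∎)
  where
  open ≡-Reasoning
  P≤n : ℕ → Bool
  P≤n y = (y ≤ᵇ n) ∧ P y
  guarded : cnt P≤n 1 n ≡ cnt P 1 n
  guarded = cnt-cong P≤n P 1 n (λ y _ y≤n → cong (_∧ P y) (Equivalence.to T-≡ (ℕP.≤⇒≤ᵇ (ℕP.<⇒≤pred y≤n))))
  beyond : cnt P≤n (1 + n) e ≡ 0
  beyond = cnt-none P≤n (1 + n) e (λ y n<y _ h → ℕP.<⇒≱ n<y (ℕP.≤ᵇ⇒≤ y n (proj₁ (∧-elim {y ≤ᵇ n} h))))

offset-< : ∀ {j x m} → j < m ∸ x → x + j < m
offset-< {j} {x} {m} j< with x ℕP.≤? m
... | yes x≤m = subst (_≤ m) (cong suc (ℕP.+-comm j x)) (ℕP.m≤o∸n⇒m+n≤o (suc j) x≤m j<)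
... | no  x≰m = ⊥-elim (ℕP.n≮0 (subst (j <_) (ℕP.m≤n⇒m∸n≡0 (ℕP.<⇒≤ (ℕP.≰⇒> x≰m))) j<))

last-index : ∀ {a b} → a ≤ b → suc a + (b ∸ a) ≡ suc b
last-index a≤b = cong suc (ℕP.m+[n∸m]≡n a≤b)

∸-telescope : ∀ {x y z} → x ≤ y → y ≤ z → (y ∸ x) + (z ∸ y) ≡ z ∸ x
∸-telescope {x} {y} {z} x≤y y≤z = ℕP.+-cancelˡ-≡ x _ _ (begin
  x + ((y ∸ x) + (z ∸ y)) ≡⟨ ℕP.+-assoc x (y ∸ x) (z ∸ y) ⟨
  (x + (y ∸ x)) + (z ∸ y) ≡⟨ cong (_+ (z ∸ y)) (ℕP.m+[n∸m]≡n x≤y) ⟩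
  y + (z ∸ y)             ≡⟨ ℕP.m+[n∸m]≡n y≤z ⟩
  z                       ≡⟨ ℕP.m+[n∸m]≡n (ℕP.≤-trans x≤y y≤z) ⟨
  x + (z ∸ x)             ∎)
  where open ≡-Reasoning

-- Balance is additive over concatenation, so
-- if every U-index starts (resp. ends) a block balanced for a larger test I,
-- a greedy left-to-right (resp. right-to-left) sweep shows that the whole
-- interval is balanced for U.
module Covering (α β : ℚ) (α≥0 : 0ℚ ℚ.≤ α) (β≥0 : 0ℚ ℚ.≤ β) (C : ℕ → Bool) where

  Balanced : (ℕ → Bool) → ℕ → ℕ → Set
  Balanced P a m = α ℚ.* ⟦ cnt P a m ⟧ ℚ.≤ β ℚ.* ⟦ cnt C a m ⟧

  balanced-empty : ∀ P a → Balanced P a 0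
  balanced-empty P a rewrite ⟦0⟧ | ℚP.*-zeroʳ α | ℚP.*-zeroʳ β = ℚP.≤-refl

  balanced-++ : ∀ P a m t → Balanced P a m → Balanced P (a + m) t → Balanced P a (m + t)
  balanced-++ P a m t left right =
    subst₂ ℚ._≤_ (sym (weigh α P)) (sym (weigh β C)) (ℚP.+-mono-≤ left right)
    where
    weigh : ∀ γ Q → γ ℚ.* ⟦ cnt Q a (m + t) ⟧ ≡ γ ℚ.* ⟦ cnt Q a m ⟧ ℚ.+ γ ℚ.* ⟦ cnt Q (a + m) t ⟧
    weigh γ Q = trans (cong (λ z → γ ℚ.* ⟦ z ⟧) (cnt-++ Q a m t)) (⟦⟧-distrib γ _ _)

  balanced-sub : ∀ P Q a m → OnRange a m (P ⇒ Q) → Balanced Q a m → Balanced P a m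
  balanced-sub P Q a m P⇒Q bal = ℚP.≤-trans (scale α≥0 (⟦⟧-mono (cnt-mono P Q a m P⇒Q))) bal

  balanced-cons : ∀ P a m → ¬ T (P a) → Balanced P (suc a) m → Balanced P a (suc m)
  balanced-cons P a m ¬pa bal rewrite cnt-cons-no P a m ¬pa =
    ℚP.≤-trans bal (scale β≥0 (⟦⟧-mono (cnt-tail-≤ C a m)))

  balanced-snoc : ∀ P a m → ¬ T (P (a + m)) → Balanced P a m → Balanced P a (suc m)
  balanced-snoc P a m ¬p bal rewrite cnt-snoc-no P a m ¬p =
    ℚP.≤-trans bal (scale β≥0 (⟦⟧-mono (cnt-init-≤ C a m)))

  module _ (U I : ℕ → Bool) (U⊆I : ∀ y → (U ⇒ I) y) where

    RightBlocks : ℕ → Set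
    RightBlocks E = ∀ x → T (U x) → x < E → Σ ℕ λ e → x < e × e ≤ E × Balanced I x (e ∸ x)

    cover-right : ∀ E → RightBlocks E → ∀ m a → a + m ≡ E → Balanced U a m
    cover-right E blocks = <-rec Motive sweep
      where
      Motive : ℕ → Set
      Motive m = ∀ a → a + m ≡ E → Balanced U a m
      sweep : ∀ m → (∀ {m'} → m' < m → Motive m') → Motive m
      sweep zero    _   a _ = balanced-empty U a
      sweep (suc m) rec a a+m≡E with T? (U a)
      ... | no ¬ua = balanced-cons U a m ¬ua (rec ℕP.≤-refl (suc a) (trans (sym (ℕP.+-suc a m)) a+m≡E))
      ... | yes ua with blocks a ua (subst (a <_) a+m≡E (ℕP.m<m+n a z<s))
      ...   | e , a<e , e≤E , block = subst (Balanced U a) t+rest≡ (balanced-++ U a t rest first later)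
        where
        t = e ∸ a
        t≤ : t ≤ suc m
        t≤ = subst (t ≤_) (trans (cong (_∸ a) (sym a+m≡E)) (ℕP.m+n∸m≡n a (suc m))) (ℕP.∸-monoˡ-≤ a e≤E)
        rest = suc m ∸ t
        t+rest≡ : t + rest ≡ suc m
        t+rest≡ = ℕP.m+[n∸m]≡n t≤
        first : Balanced U a t
        first = balanced-sub U I a t (λ y _ _ → U⊆I y) block
        later : Balanced U (a + t) rest
        later = rec (s≤s (ℕP.∸-monoʳ-≤ (suc m) (ℕP.m<n⇒0<n∸m a<e)))
                    (a + t) (trans (ℕP.+-assoc a t rest) (trans (cong (a +_) t+rest≡) a+m≡E))

    LeftBlocks : ℕ → Set
    LeftBlocks s₀ = ∀ x → T (U x) → s₀ ≤ x → Σ ℕ λ s → s₀ ≤ s × s ≤ x × Balanced I s (suc x ∸ s)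

    cover-left : ∀ s₀ → LeftBlocks s₀ → ∀ m → Balanced U s₀ m
    cover-left s₀ blocks = <-rec (Balanced U s₀) sweep
      where
      sweep : ∀ m → (∀ {m'} → m' < m → Balanced U s₀ m') → Balanced U s₀ m
      sweep zero    _   = balanced-empty U s₀
      sweep (suc m) rec with T? (U (s₀ + m))
      ... | no ¬ux = balanced-snoc U s₀ m ¬ux (rec ℕP.≤-refl)
      ... | yes ux with blocks (s₀ + m) ux (ℕP.m≤m+n s₀ m)
      ...   | s , s₀≤s , s≤x , block = subst (Balanced U s₀) rest+t≡ (balanced-++ U s₀ rest t earlier last)
        where
        rest = s ∸ s₀
        t = suc (s₀ + m) ∸ s
        rest+t≡ : rest + t ≡ suc m
        rest+t≡ = trans (∸-telescope s₀≤s (ℕP.m≤n⇒m≤1+n s≤x))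
                    (trans (cong (_∸ s₀) (sym (ℕP.+-suc s₀ m))) (ℕP.m+n∸m≡n s₀ (suc m)))
        earlier : Balanced U s₀ rest
        earlier = rec (s≤s (subst (rest ≤_) (ℕP.m+n∸m≡n s₀ m) (ℕP.∸-monoˡ-≤ s₀ s≤x)))
        last : Balanced U (s₀ + rest) t
        last = subst (λ z → Balanced U z t) (sym (ℕP.m+[n∸m]≡n s₀≤s))
                 (balanced-sub U I s t (λ y _ _ → U⊆I y) block)

module Columns (c : ℕ → ℕ) (r : ℕ) (incr : ∀ j → j < r → c j < c (suc j)) where

  cut-mono : ∀ {i j} → i ≤ j → j ≤ r → c i ≤ c j
  cut-mono {i} {zero}  z≤n _ = ℕP.≤-refl
  cut-mono {i} {suc j} i≤j+1 j<r with ℕP.m≤n⇒m<n∨m≡n i≤j+1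
  ... | inj₂ refl      = ℕP.≤-refl
  ... | inj₁ (s≤s i≤j) = ℕP.≤-trans (cut-mono i≤j (ℕP.<⇒≤ j<r)) (ℕP.<⇒≤ (incr j j<r))

  column-order : ∀ {i m y} → i ≤ r → c i < y → y ≤ c m → i < m
  column-order {i} {m} i≤r ci<y y≤cm with i ℕP.<? m
  ... | yes i<m = i<m
  ... | no  i≮m = ⊥-elim (ℕP.<⇒≱ (ℕP.<-≤-trans ci<y y≤cm) (cut-mono (ℕP.≮⇒≥ i≮m) i≤r))

  locate : ∀ j → j ≤ r → ∀ y → c 0 < y → y ≤ c j →
           Σ ℕ λ m → 1 ≤ m × m ≤ j × c (m ∸ 1) < y × y ≤ c m
  locate zero    _   y c0<y y≤c0 = ⊥-elim (ℕP.<⇒≱ c0<y y≤c0)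
  locate (suc j) j<r y c0<y y≤cj+1 with y ℕP.≤? c j
  ... | yes y≤cj = let (m , 1≤m , m≤j , lo , hi) = locate j (ℕP.<⇒≤ j<r) y c0<y y≤cj
                   in m , 1≤m , ℕP.m≤n⇒m≤1+n m≤j , lo , hi
  ... | no  y≰cj = suc j , s≤s z≤n , ℕP.≤-refl , ℕP.≰⇒> y≰cj , y≤cj+1

  width-column : ∀ j → j ≤ r → ∀ {i x} → 1 ≤ i → i ≤ j → c (i ∸ 1) < x → x ≤ c i →
                 widthAux c j x ≡ c i ∸ c (i ∸ 1)
  width-column (suc j) j<r {suc i} {x} _ (s≤s i≤j) lo hi with ℕP.m≤n⇒m<n∨m≡n i≤j
  ... | inj₂ refl rewrite Equivalence.to T-≡ (ℕP.<⇒<ᵇ lo) | Equivalence.to T-≡ (ℕP.≤⇒≤ᵇ hi) = refl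
  ... | inj₁ i<j with c j <ᵇ x in cj<x
  ...   | false = width-column j (ℕP.<⇒≤ j<r) (s≤s z≤n) i<j lo hi
  ...   | true  = ⊥-elim (ℕP.<⇒≱ (ℕP.<ᵇ⇒< (c j) x (subst T (sym cj<x) tt))
                                 (ℕP.≤-trans hi (cut-mono i<j (ℕP.<⇒≤ j<r))))

module Chain (n : ℕ) (f : ℕ → ℕ) (R : Box) (S : StripDec R) (k : ℕ) (D : ℕ → Box)
             (cp : Compatible R S k D) where
  open Compatible cp
  open Columns (cut S) (r S) (incr S)

  c : ℕ → ℕ
  c = cut S

  ≤k⇒≤r : ∀ {m} → m ≤ k → m ≤ r S
  ≤k⇒≤r m≤k = ℕP.≤-trans m≤k (ℕP.≤-reflexive k≡r)

  xL≤cut : ∀ j → j ≤ r S → xL R ≤ c j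
  xL≤cut j j≤r = subst (_≤ c j) (cut0 S) (cut-mono z≤n j≤r)

  cut≤xR : ∀ j → j ≤ r S → c j ≤ xR R
  cut≤xR j j≤r = subst (c j ≤_) (cutr S) (cut-mono j≤r ℕP.≤-refl)

  InColumn : ℕ → ℕ → Set
  InColumn m y = 1 ≤ m × m ≤ k × c (m ∸ 1) < y × y ≤ c m

  inBox-D : ∀ {m y v} → 1 ≤ m → m ≤ k → T (inBox (D m) y v) →
            InColumn m y × yB (D m) ≤ v × v ≤ yT (D m)
  inBox-D {m} {y} {v} 1≤m m≤k h =
    let (l , r′ , b , t) = inBox⇒ (D m) y v h
    in (1≤m , m≤k , subst (_< y) (xL-D m 1≤m m≤k) l , subst (y ≤_) (xR-D m 1≤m m≤k) r′) , b , t

  chain-order : ∀ {i m} → 1 ≤ i → i < m → m ≤ k → yT (D i) ≤ yB (D m)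
  chain-order {i} {suc m} 1≤i (s≤s i≤m) m<k with ℕP.m≤n⇒m<n∨m≡n i≤m
  ... | inj₂ refl = ℕP.≤-reflexive (proj₂ (chain i 1≤i m<k))
  ... | inj₁ i<m  = ℕP.≤-trans (chain-order 1≤i i<m (ℕP.<⇒≤ m<k))
                      (ℕP.≤-trans (yB≤yT (D m))
                        (ℕP.≤-reflexive (proj₂ (chain m (ℕP.≤-trans 1≤i (ℕP.<⇒≤ i<m)) m<k))))

  inC : ℕ → Bool
  inC = inChain f k D

  inR : ℕ → Bool
  inR y = inBox R y (f y)

  inR⇒ : ∀ y → T (inR y) → xL R < y × y ≤ xR R × T (inY R (f y))
  inR⇒ y h = let (l , h′) = ∧-elim {xL R <ᵇ y} h ; (r′ , v) = ∧-elim {y ≤ᵇ xR R} h′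
               in ℕP.<ᵇ⇒< _ _ l , ℕP.≤ᵇ⇒≤ _ _ r′ , v

  inR⇐ : ∀ {y} → xL R < y → y ≤ xR R → T (inY R (f y)) → T (inR y)
  inR⇐ l r′ v = ∧-intro (ℕP.<⇒<ᵇ l) (∧-intro (ℕP.≤⇒≤ᵇ r′) v)

  chain-member : ∀ x → T (inC x) → Σ ℕ λ m → InColumn m x × yB (D m) ≤ f x × f x ≤ yT (D m)
  chain-member x h = let (j , j<k , p) = AnyP.applyUpTo⁻ _ (AnyP.any⁻ _ _ h)
                   in suc j , inBox-D (s≤s z≤n) j<k p

  chain⊆R : ∀ y → T (inC y) → T (inR y)
  chain⊆R y h =
    let (m , (1≤m , m≤k , lo , hi) , b , t) = chain-member y h
    in inR⇐ {y} (ℕP.≤-<-trans (xL≤cut (m ∸ 1) (≤k⇒≤r (ℕP.≤-trans (ℕP.m∸n≤m m 1) m≤k))) lo)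
                (ℕP.≤-trans hi (cut≤xR m (≤k⇒≤r m≤k)))
                (∧-intro (ℕP.≤⇒≤ᵇ (ℕP.≤-trans (yB-D m 1≤m m≤k) b)) (ℕP.≤⇒≤ᵇ (ℕP.≤-trans t (yT-D m 1≤m m≤k))))

  below : ℕ → Bool
  below y = any (λ m → (xL (D m) <ᵇ y) ∧ (y ≤ᵇ xR (D m)) ∧ (f y <ᵇ yB (D m))) (ivl 0 k)

  In Out Below Above : ℕ → Bool
  In y    = (y ≤ᵇ n) ∧ inC y
  Out y   = (y ≤ᵇ n) ∧ (inR y ∧ not (inC y))
  Below y = Out y ∧ below y
  Above y = Out y ∧ not (below y)

  In⇒¬Out : ∀ y → T (In y) → ¬ T (Out y)
  In⇒¬Out y i o = not⇒¬ (proj₂ (∧-elim {inR y} (proj₂ (∧-elim {y ≤ᵇ n} o)))) (proj₂ (∧-elim {y ≤ᵇ n} i))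

  under-chain : ∀ {y} → y ≤ n → T (inR y) → (∀ m → InColumn m y → f y < yB (D m)) → T (Below y)
  under-chain {y} y≤n y∈R under = ∧-intro (∧-intro (ℕP.≤⇒≤ᵇ y≤n) (∧-intro y∈R (¬⇒not off-chain))) below-y
    where
    off-chain : ¬ T (inC y)
    off-chain h = let (m , col , b , _) = chain-member y h in ℕP.<⇒≱ (under m col) b
    below-y : T (below y)
    below-y with inR⇒ y y∈R
    ... | xL<y , y≤xR , _ with locate (r S) ℕP.≤-refl y (subst (_< y) (sym (cut0 S)) xL<y)
                                  (subst (y ≤_) (sym (cutr S)) y≤xR)
    ...   | suc j , 1≤m , m≤r , lo , hi =
      let m≤k = subst (suc j ≤_) (sym k≡r) m≤r in
      AnyP.any⁺ _ (AnyP.applyUpTo⁺ _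
        (∧-intro (ℕP.<⇒<ᵇ (subst (_< y) (sym (xL-D (suc j) 1≤m m≤k)) lo))
          (∧-intro (ℕP.≤⇒≤ᵇ (subst (y ≤_) (sym (xR-D (suc j) 1≤m m≤k)) hi))
            (ℕP.<⇒<ᵇ (under (suc j) (1≤m , m≤k , lo , hi))))) m≤k)

  over-chain : ∀ {y} → y ≤ n → T (inR y) → (∀ m → InColumn m y → yT (D m) < f y) → T (Above y)
  over-chain {y} y≤n y∈R over = ∧-intro (∧-intro (ℕP.≤⇒≤ᵇ y≤n) (∧-intro y∈R (¬⇒not off-chain))) (¬⇒not not-below)
    where
    off-chain : ¬ T (inC y)
    off-chain h = let (m , col , _ , t) = chain-member y h in ℕP.<⇒≱ (over m col) t
    not-below : ¬ T (below y)
    not-below h =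
      let (j , j<k , p) = AnyP.applyUpTo⁻ _ (AnyP.any⁻ _ _ h)
          (l , h′) = ∧-elim {xL (D (suc j)) <ᵇ y} p
          (r′ , under) = ∧-elim {y ≤ᵇ xR (D (suc j))} h′
          col = s≤s z≤n , j<k , subst (_< y) (xL-D (suc j) (s≤s z≤n) j<k) (ℕP.<ᵇ⇒< _ _ l)
                                , subst (y ≤_) (xR-D (suc j) (s≤s z≤n) j<k) (ℕP.≤ᵇ⇒≤ _ _ r′)
      in ℕP.<⇒≱ (over (suc j) col) (ℕP.≤-trans (ℕP.<⇒≤ (ℕP.<ᵇ⇒< _ _ under)) (yB≤yT (D (suc j))))

  right-shadow : ∀ {i x y} → InColumn i x → f x ≤ yT (D i) → c i < y → f y < f x →
                 ∀ m → InColumn m y → f y < yB (D m)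
  right-shadow (1≤i , i≤k , _ , _) fx≤top ci<y fy<fx m (_ , m≤k , _ , y≤cm) =
    ℕP.<-≤-trans fy<fx (ℕP.≤-trans fx≤top (chain-order 1≤i (column-order (≤k⇒≤r i≤k) ci<y y≤cm) m≤k))

  left-shadow : ∀ {i x y} → InColumn i x → yB (D i) ≤ f x → y ≤ c (i ∸ 1) → f x < f y →
                ∀ m → InColumn m y → yT (D m) < f y
  left-shadow {suc i} (_ , i≤k , _ , _) bot≤fx y≤ci fx<fy (suc m) (1≤m , m≤k , lo , _) =
    ℕP.≤-<-trans (ℕP.≤-trans (chain-order 1≤m m<i i≤k) bot≤fx) fx<fy
    where
    m<i : suc m < suc i
    m<i = s≤s (column-order (≤k⇒≤r (ℕP.≤-trans (ℕP.n≤1+n m) m≤k)) lo y≤ci)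

  R⇒strip : ∀ {a b y} → y ≤ n → T (inR y) → a < y → y ≤ b → T (inStripF n f R a b y)
  R⇒strip y≤n y∈R a<y y≤b =
    ∧-intro (ℕP.≤⇒≤ᵇ (ℕP.≤-trans (s≤s z≤n) a<y)) (∧-intro (ℕP.≤⇒≤ᵇ y≤n)
      (∧-intro (ℕP.<⇒<ᵇ a<y) (∧-intro (ℕP.≤⇒≤ᵇ y≤b) (proj₂ (proj₂ (inR⇒ _ y∈R))))))

  strip⇒R : ∀ {a b} y → xL R ≤ a → b ≤ xR R → T (inStripF n f R a b y) → y ≤ n × a < y × y ≤ b × T (inR y)
  strip⇒R {a} {b} y xL≤a b≤xR h =
    let (_ , h₁) = ∧-elim {1 ≤ᵇ y} h ; (p₂ , h₂) = ∧-elim {y ≤ᵇ n} h₁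
        (p₃ , h₃) = ∧-elim {a <ᵇ y} h₂ ; (p₄ , v) = ∧-elim {y ≤ᵇ b} h₃
        a<y = ℕP.<ᵇ⇒< _ _ p₃ ; y≤b = ℕP.≤ᵇ⇒≤ _ _ p₄
    in ℕP.≤ᵇ⇒≤ _ _ p₂ , a<y , y≤b , inR⇐ (ℕP.≤-<-trans xL≤a a<y) (ℕP.≤-trans y≤b b≤xR) v

  In⇒strip : ∀ {a b y} → a < y → y ≤ b → T (In y) → T (inStripF n f R a b y)
  In⇒strip {y = y} a<y y≤b h = let (y≤n , y∈C) = ∧-elim {y ≤ᵇ n} h
                               in R⇒strip (ℕP.≤ᵇ⇒≤ _ _ y≤n) (chain⊆R y y∈C) a<y y≤b

  Out⇒strip : ∀ {a b y} → a < y → y ≤ b → T (Out y) → T (inStripF n f R a b y)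
  Out⇒strip {y = y} a<y y≤b h = let (y≤n , rest) = ∧-elim {y ≤ᵇ n} h
                                in R⇒strip (ℕP.≤ᵇ⇒≤ _ _ y≤n) (proj₁ (∧-elim {inR y} rest)) a<y y≤b

  Below⊆Out : ∀ y → T (Below y) → T (Out y)
  Below⊆Out y h = proj₁ (∧-elim {Out y} h)

  Above⊆Out : ∀ y → T (Above y) → T (Out y)
  Above⊆Out y h = proj₁ (∧-elim {Out y} h)

  Violator : ℕ → ℕ → ℕ → ℕ → Bool
  Violator x lo hi y = inStripF n f R lo hi y ∧ violB f x y

  width-right : ∀ {i x} → InColumn i x → suc (c i ∸ x) ≤ stripWidth S x
  width-right {i} {x} (1≤i , i≤k , lo , hi) =
    subst (suc (c i ∸ x) ≤_) (sym (width-column (r S) ℕP.≤-refl 1≤i (≤k⇒≤r i≤k) lo hi)) (ℕP.∸-monoʳ-< lo hi)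

  width-left : ∀ {i x′} → InColumn i (suc x′) → suc (x′ ∸ c (i ∸ 1)) ≤ stripWidth S (suc x′)
  width-left {i} {x′} (1≤i , i≤k , lo , hi) =
    subst₂ _≤_ (ℕP.+-∸-assoc 1 (ℕP.<⇒≤pred lo)) (sym (width-column (r S) ℕP.≤-refl 1≤i (≤k⇒≤r i≤k) lo hi))
      (ℕP.∸-monoˡ-≤ (c (i ∸ 1)) hi)

  right-violators : ∀ {i x b} → InColumn i x → f x ≤ yT (D i) → b ≤ xR R →
    OnRange (suc x) (b ∸ x) (λ y → T (Violator x x b y) → T (y ≤ᵇ c i) ⊎ T (Below y))
  right-violators {i} {x} {b} col@(_ , i≤k , lo , _) fx≤top b≤xR y _ _ v with y ℕP.≤? c i
  ... | yes y≤ci = inj₁ (ℕP.≤⇒≤ᵇ y≤ci)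
  ... | no  y≰ci =
    let (sv , vv) = ∧-elim {inStripF n f R x b y} v
        (y≤n , x<y , _ , y∈R) = strip⇒R y (ℕP.<⇒≤ (ℕP.≤-<-trans (xL≤cut (i ∸ 1) (≤k⇒≤r (ℕP.≤-trans (ℕP.m∸n≤m i 1) i≤k))) lo)) b≤xR sv
    in inj₂ (under-chain y≤n y∈R (right-shadow col fx≤top (ℕP.≰⇒> y≰ci) (viol-right f x<y vv)))

  left-violators : ∀ {i x′ a} → InColumn i (suc x′) → yB (D i) ≤ f (suc x′) → xL R ≤ a →
    OnRange (suc a) (x′ ∸ a) (λ y → T (Violator (suc x′) a x′ y) → T (c (i ∸ 1) <ᵇ y) ⊎ T (Above y))
  left-violators {i} {x′} {a} col@(_ , i≤k , _ , hi) bot≤fx xL≤a y _ _ v with c (i ∸ 1) ℕP.<? y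
  ... | yes ci<y = inj₁ (ℕP.<⇒<ᵇ ci<y)
  ... | no  ci≮y =
    let (sv , vv) = ∧-elim {inStripF n f R a x′ y} v
        (y≤n , _ , y≤x′ , y∈R) = strip⇒R y xL≤a (ℕP.≤-trans (ℕP.n≤1+n x′) (ℕP.≤-trans hi (cut≤xR i (≤k⇒≤r i≤k)))) sv
    in inj₂ (over-chain y≤n y∈R (left-shadow col bot≤fx (ℕP.≮⇒≥ ci≮y) (viol-left f (s≤s y≤x′) vv)))

  module Local (μ : ℚ) (μ≥0 : 0ℚ ℚ.≤ μ) (μ≤1 : μ ℚ.≤ 1ℚ) where

    unsafe-bound : ∀ x lo hi s → ¬ T (Z n f μ R x lo hi ℚ.≤ᵇ toℚ s) →
      ⟦ s ⟧ ℚ.≤ ⟦ cnt (Violator x lo hi) (suc lo) (hi ∸ lo) ⟧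
                ℚ.- μ ℚ.* ⟦ cnt (inStripF n f R lo hi) (suc lo) (hi ∸ lo) ⟧
    unsafe-bound x lo hi s unsafe =
      subst₂ ℚ._≤_ (sym (⟦⟧≡toℚ s)) (cong₂ (λ v c → v ℚ.- μ ℚ.* c) (as-cnt _) (as-cnt _))
        (ℚP.<⇒≤ (ℚP.≰⇒> (λ le → unsafe (ℚP.≤⇒≤ᵇ le))))
      where
      as-cnt : ∀ P → toℚ (countB P (ivl lo hi)) ≡ ⟦ cnt P (suc lo) (hi ∸ lo) ⟧
      as-cnt P = trans (cong toℚ (countB-ivl P lo hi)) (sym (⟦⟧≡toℚ _))

    strip-estimate : ∀ (Q W : ℕ → Bool) x lo hi s w → lo ≤ hi → (∀ y → T (Q y) → T (Out y)) →
      OnRange (suc lo) (hi ∸ lo) (λ y → T (Violator x lo hi y) → T (W y) ⊎ T (Q y)) →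
      cnt W (suc lo) (hi ∸ lo) ≤ w → suc w ≤ s → ¬ T (Z n f μ R x lo hi ℚ.≤ᵇ toℚ s) →
      μ ℚ.* ⟦ suc (cnt In (suc lo) (hi ∸ lo)) ⟧ ℚ.≤ (1ℚ ℚ.- μ) ℚ.* ⟦ cnt Q (suc lo) (hi ∸ lo) ⟧
    strip-estimate Q W x lo hi s w lo≤hi Q⊆Out split window w<s unsafe =
      unsafe-strip-arith μ μ≥0 μ≤1 few-escape disjoint (unsafe-bound x lo hi s unsafe)
      where
      m = hi ∸ lo
      few-escape : suc (cnt (Violator x lo hi) (suc lo) m) ≤ s + cnt Q (suc lo) m
      few-escape = ℕP.≤-trans (s≤s (ℕP.≤-trans (cnt-cover _ W Q (suc lo) m split) (ℕP.+-monoˡ-≤ _ window)))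
                              (ℕP.+-monoˡ-≤ _ w<s)
      ≤hi : ∀ {y} → y < suc lo + m → y ≤ hi
      ≤hi y< = ℕP.≤-trans (ℕP.<⇒≤pred y<) (ℕP.≤-reflexive (ℕP.m+[n∸m]≡n lo≤hi))
      disjoint : cnt In (suc lo) m + cnt Q (suc lo) m ≤ cnt (inStripF n f R lo hi) (suc lo) m
      disjoint = cnt-disjoint In Q _ (suc lo) m
        (λ y lo<y y< → In⇒strip lo<y (≤hi y<))
        (λ y lo<y y< q → Out⇒strip lo<y (≤hi y<) (Q⊆Out y q))
        (λ y _ _ i q → In⇒¬Out y i (Q⊆Out y q))

    right-estimate : ∀ {i x b} → InColumn i x → f x ≤ yT (D i) → T (In x) → x < b → b ≤ xR R →
      ¬ T (Z n f μ R x x b ℚ.≤ᵇ toℚ (stripWidth S x)) →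
      μ ℚ.* ⟦ cnt In x (suc (b ∸ x)) ⟧ ℚ.≤ (1ℚ ℚ.- μ) ℚ.* ⟦ cnt Below x (suc (b ∸ x)) ⟧
    right-estimate {i} {x} {b} col fx≤top x∈In x<b b≤xR unsafe =
      subst₂ (λ u v → μ ℚ.* ⟦ u ⟧ ℚ.≤ (1ℚ ℚ.- μ) ℚ.* ⟦ v ⟧)
        (sym (cnt-cons-yes In x (b ∸ x) x∈In))
        (sym (cnt-cons-no Below x (b ∸ x) (λ bel → In⇒¬Out x x∈In (Below⊆Out x bel))))
        (strip-estimate Below (_≤ᵇ c i) x x b (stripWidth S x) (c i ∸ x) (ℕP.<⇒≤ x<b) Below⊆Out
          (right-violators col fx≤top b≤xR) (cnt-≤ᵇ (c i) (suc x) (b ∸ x)) (width-right col) unsafe)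

    left-estimate : ∀ {i x′ a} → InColumn i (suc x′) → yB (D i) ≤ f (suc x′) → T (In (suc x′)) →
      xL R ≤ a → a < x′ → ¬ T (Z n f μ R (suc x′) a x′ ℚ.≤ᵇ toℚ (stripWidth S (suc x′))) →
      μ ℚ.* ⟦ cnt In (suc a) (suc (x′ ∸ a)) ⟧ ℚ.≤ (1ℚ ℚ.- μ) ℚ.* ⟦ cnt Above (suc a) (suc (x′ ∸ a)) ⟧
    left-estimate {i} {x′} {a} col bot≤fx x∈In xL≤a a<x′ unsafe =
      subst₂ (λ u v → μ ℚ.* ⟦ u ⟧ ℚ.≤ (1ℚ ℚ.- μ) ℚ.* ⟦ v ⟧)
        (sym (cnt-snoc-yes In (suc a) (x′ ∸ a) (subst (T ∘ In) (sym ends-at-x) x∈In)))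
        (sym (cnt-snoc-no Above (suc a) (x′ ∸ a)
          (λ abv → In⇒¬Out (suc x′) x∈In (Above⊆Out (suc x′) (subst (T ∘ Above) ends-at-x abv)))))
        (strip-estimate Above (c (i ∸ 1) <ᵇ_) (suc x′) a x′ (stripWidth S (suc x′)) (x′ ∸ c (i ∸ 1))
          (ℕP.<⇒≤ a<x′) Above⊆Out (left-violators col bot≤fx xL≤a) window (width-left col) unsafe)
      where
      ends-at-x : suc a + (x′ ∸ a) ≡ suc x′
      ends-at-x = last-index (ℕP.<⇒≤ a<x′)
      window : cnt (c (i ∸ 1) <ᵇ_) (suc a) (x′ ∸ a) ≤ x′ ∸ c (i ∸ 1)
      window = subst (λ e → cnt (c (i ∸ 1) <ᵇ_) (suc a) (x′ ∸ a) ≤ e ∸ suc (c (i ∸ 1))) ends-at-x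
                 (cnt->ᵇ (c (i ∸ 1)) (suc a) (x′ ∸ a))

  module Assembly (μ : ℚ) (μ≥0 : 0ℚ ℚ.≤ μ) (μ≤1 : μ ℚ.≤ 1ℚ) where
    open Local μ μ≥0 μ≤1

    1-μ≥0 : 0ℚ ℚ.≤ 1ℚ ℚ.- μ
    1-μ≥0 = subst (ℚ._≤ 1ℚ ℚ.- μ) (ℚP.+-inverseʳ μ) (ℚP.+-monoˡ-≤ (ℚ.- μ) μ≤1)

    safe-right safe-left : ℕ → Bool
    safe-right x = all (λ b → Z n f μ R x x b ℚ.≤ᵇ toℚ (stripWidth S x)) (ivl x (xR R))
    safe-left  x = all (λ a → Z n f μ R x a (x ∸ 1) ℚ.≤ᵇ toℚ (stripWidth S x))
                       (applyUpTo (λ i → xL R + i) ((x ∸ 1) ∸ xL R))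

    UnsafeRight UnsafeLeft : ℕ → Bool
    UnsafeRight x = (x ≤ᵇ n) ∧ (inC x ∧ not (safe-right x))
    UnsafeLeft  x = (x ≤ᵇ n) ∧ (inC x ∧ not (safe-left x))

    UnsafeRight⊆In : ∀ y → T (UnsafeRight y) → T (In y)
    UnsafeRight⊆In y u = proj₁ (∧-not-elim {y ≤ᵇ n} {inC y} {safe-right y} u)

    UnsafeLeft⊆In : ∀ y → T (UnsafeLeft y) → T (In y)
    UnsafeLeft⊆In y u = proj₁ (∧-not-elim {y ≤ᵇ n} {inC y} {safe-left y} u)

    module BelowCover = Covering μ (1ℚ ℚ.- μ) μ≥0 1-μ≥0 Below
    module AboveCover = Covering μ (1ℚ ℚ.- μ) μ≥0 1-μ≥0 Above

    -- all indices concerned lie in [1 , 1 + M)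
    M : ℕ
    M = n + xR R

    right-blocks : BelowCover.RightBlocks UnsafeRight In UnsafeRight⊆In (1 + M)
    right-blocks x ux _ =
      let (x∈In , not-safe) = ∧-not-elim {x ≤ᵇ n} {inC x} ux
          (j , j< , unsafe) = all-failure _ (λ i → suc (x + i)) (xR R ∸ x) not-safe
          (i , col , _ , fx≤top) = chain-member x (proj₂ (∧-elim {x ≤ᵇ n} x∈In))
          x<b = s≤s (ℕP.m≤m+n x j)
          b≤xR = offset-< j<
      in suc (suc (x + j)) , ℕP.m≤n⇒m≤1+n x<b , s≤s (ℕP.≤-trans b≤xR (ℕP.m≤n+m (xR R) n)) ,
         subst (BelowCover.Balanced In x) (sym (ℕP.+-∸-assoc 1 (ℕP.<⇒≤ x<b)))
           (right-estimate col fx≤top x∈In x<b b≤xR unsafe)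

    left-blocks : AboveCover.LeftBlocks UnsafeLeft In UnsafeLeft⊆In 1
    left-blocks (suc x′) ux _ =
      let (x∈In , not-safe) = ∧-not-elim {suc x′ ≤ᵇ n} {inC (suc x′)} ux
          (j , j< , unsafe) = all-failure _ (λ i → xL R + i) (x′ ∸ xL R) not-safe
          (i , col , bot≤fx , _) = chain-member (suc x′) (proj₂ (∧-elim {suc x′ ≤ᵇ n} x∈In))
          a<x′ = offset-< j<
      in suc (xL R + j) , s≤s z≤n , s≤s (ℕP.<⇒≤ a<x′) ,
         subst (AboveCover.Balanced In (suc (xL R + j))) (sym (ℕP.+-∸-assoc 1 (ℕP.<⇒≤ a<x′)))
           (left-estimate col bot≤fx x∈In (ℕP.m≤m+n (xL R) j) a<x′ unsafe)

    UnsafeIdx Outside : ℕ → Bool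
    UnsafeIdx x  = inC x ∧ not (isSafe n f μ R S x)
    Outside y = inR y ∧ not (inC y)

    unsafe-split : cnt UnsafeIdx 1 n ≤ cnt UnsafeRight 1 M + cnt UnsafeLeft 1 M
    unsafe-split = ℕP.≤-trans (ℕP.≤-reflexive (cnt-guard UnsafeIdx n (xR R)))
      (cnt-cover _ UnsafeRight UnsafeLeft 1 M (λ y _ _ → ∧-not-split (y ≤ᵇ n) (inC y) (safe-right y) (safe-left y)))

    outside-split : cnt Outside 1 n ≡ cnt Below 1 M + cnt Above 1 M
    outside-split = trans (cnt-guard Outside n (xR R)) (cnt-∧-split Out below 1 M)

    key-inequality : μ ℚ.* ⟦ cnt UnsafeIdx 1 n ⟧ ℚ.≤ (1ℚ ℚ.- μ) ℚ.* ⟦ cnt Outside 1 n ⟧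
    key-inequality = begin
      μ ℚ.* ⟦ cnt UnsafeIdx 1 n ⟧                                   ≤⟨ scale μ≥0 (⟦⟧-mono unsafe-split) ⟩
      μ ℚ.* ⟦ cnt UnsafeRight 1 M + cnt UnsafeLeft 1 M ⟧            ≡⟨ ⟦⟧-distrib μ _ _ ⟩
      μ ℚ.* ⟦ cnt UnsafeRight 1 M ⟧ ℚ.+ μ ℚ.* ⟦ cnt UnsafeLeft 1 M ⟧ ≤⟨ ℚP.+-mono-≤ right left ⟩
      (1ℚ ℚ.- μ) ℚ.* ⟦ cnt Below 1 M ⟧ ℚ.+ (1ℚ ℚ.- μ) ℚ.* ⟦ cnt Above 1 M ⟧ ≡⟨ ⟦⟧-distrib (1ℚ ℚ.- μ) _ _ ⟨
      (1ℚ ℚ.- μ) ℚ.* ⟦ cnt Below 1 M + cnt Above 1 M ⟧              ≡⟨ cong (λ z → (1ℚ ℚ.- μ) ℚ.* ⟦ z ⟧) outside-split ⟨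
      (1ℚ ℚ.- μ) ℚ.* ⟦ cnt Outside 1 n ⟧                            ∎
      where
      open ℚP.≤-Reasoning
      right = BelowCover.cover-right UnsafeRight In UnsafeRight⊆In (1 + M) right-blocks M 1 refl
      left  = AboveCover.cover-left UnsafeLeft In UnsafeLeft⊆In 1 left-blocks M

    countB-dom : ∀ P → countB P (dom n) ≡ cnt P 1 n
    countB-dom P = countB-ivl P 0 n

    chain-split : chiIn n f k D ≡ numSafeIdx n f μ R S k D + numUnsafeIdx n f μ R S k D
    chain-split = trans (countB-dom inC) (trans (cnt-∧-split inC (isSafe n f μ R S) 1 n)
                    (sym (cong₂ _+_ (countB-dom _) (countB-dom _))))

    box-split : chi n f R ≡ (numSafeIdx n f μ R S k D + numUnsafeIdx n f μ R S k D) + cnt Outside 1 n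
    box-split = begin
      chi n f R                                            ≡⟨ countB-dom inR ⟩
      cnt inR 1 n                                          ≡⟨ cnt-∧-split inR inC 1 n ⟩
      cnt (λ y → inR y ∧ inC y) 1 n + cnt Outside 1 n      ≡⟨ cong (_+ cnt Outside 1 n) (cnt-cong _ inC 1 n (λ y _ _ → ∧-absorb (inR y) (inC y) (chain⊆R y))) ⟩
      cnt inC 1 n + cnt Outside 1 n                        ≡⟨ cong (_+ cnt Outside 1 n) (trans (sym (countB-dom inC)) chain-split) ⟩
      (numSafeIdx n f μ R S k D + numUnsafeIdx n f μ R S k D) + cnt Outside 1 n ∎
      where open ≡-Reasoning

    key-inequality′ : μ ℚ.* ⟦ numUnsafeIdx n f μ R S k D ⟧ ℚ.≤ (1ℚ ℚ.- μ) ℚ.* ⟦ cnt Outside 1 n ⟧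
    key-inequality′ = subst (λ u → μ ℚ.* ⟦ u ⟧ ℚ.≤ (1ℚ ℚ.- μ) ℚ.* ⟦ cnt Outside 1 n ⟧) (sym (countB-dom UnsafeIdx)) key-inequality


lemma5p10 : (n : ℕ) (f : ℕ → ℕ) → (∀ x → 1 ℕ.≤ x → x ℕ.≤ n → 1 ℕ.≤ f x) →
            (R : Box) (S : StripDec R) (μ : ℚ) → 0ℚ ℚ.< μ → μ ℚ.< 1ℚ →
            .{{_ : ℚ.NonZero (1ℚ ℚ.- μ)}} →
            (k : ℕ) (D : ℕ → Box) → Compatible R S k D →
            (chiOut n f R k D ℚ.≥ (μ ℚ.÷ (1ℚ ℚ.- μ)) ℚ.* toℚ (numUnsafeIdx n f μ R S k D))
            × (toℚ (chiIn n f k D) ℚ.≤ (1ℚ ℚ.- μ) ℚ.* toℚ (chi n f R) ℚ.+ μ ℚ.* toℚ (numSafeIdx n f μ R S k D))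
lemma5p10 n f _ R S μ 0<μ μ<1 k D cp =
  closing-bounds μ 0<μ μ<1 (chi n f R) (chiIn n f k D) _ _ _ box-split chain-split key-inequality′
  where open Chain.Assembly n f R S k D cp μ (ℚP.<⇒≤ 0<μ) (ℚP.<⇒≤ μ<1)
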